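{- Let $\mathcal{K}$ be a class of $\mathcal{L}$-algebras and $\mathbf{C}$ a subalgebra of $\mathbf{F}_{\mathcal{K}}(\omega)$. (a) For every finite set $\Sigma$ of $\mathcal{L}$-equations, $\Sigma$ is $\mathcal{K}$-unifiable iff $\Sigma$ is $\mathbf{C}$-satisfiable. (b) If $\mathbf{C}$ is a smallest (in cardinality) finite subalgebra of $\mathbf{F}_{\mathcal{K}}(\omega)$ and $\mathcal{K}'$ is a class of $\mathcal{L}$-algebras such that for every finite set $\Sigma$ of $\mathcal{L}$-equations, $\Sigma$ is $\mathcal{K}$-unifiable iff $\Sigma$ is $\mathcal{K}'$-satisfiable, then $|C|\le|B|$ for every $\mathbf{B}\in\mathcal{K}'$.
   Context: $\mathbf{Tm}_{\mathcal{L}}$ is the term algebra over a fixed countably infinite set of variables; an $\mathcal{L}$-equation is a pair of terms $\varphi\approx\psi$. A finite set $\Sigma$ of equations is satisfiable in a class $\mathcal{C}$ (or in an algebra) if there are $\mathbf{A}\in\mathcal{C}$ and a homomorphism $h:\mathbf{Tm}_{\mathcal{L}}\to\mathbf{A}$ with $h(\varphi)=h(\psi)$ for all $(\varphi\approx\psi)\in\Sigma$. $\Sigma$ is $\mathcal{K}$-unifiable if there is a homomorphism $\sigma:\mathbf{Tm}_{\mathcal{L}}\to\mathbf{Tm}_{\mathcal{L}}$ such that $\sigma(\varphi)\approx\sigma(\psi)$ holds in every algebra of $\mathcal{K}$ under every assignment, for all $(\varphi\approx\psi)\in\Sigma$. $\mathbf{F}_{\mathcal{K}}(\omega)$ is the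 free algebra of $\mathcal{K}$ on countably many generators: $\mathbf{Tm}_{\mathcal{L}}(X)/\theta_{\mathcal{K}}(X)$, $X$ countably infinite, $\theta_{\mathcal{K}}(X)$ the intersection of all congruences $\phi$ with $\mathbf{Tm}_{\mathcal{L}}(X)/\phi$ isomorphic to a subalgebra of a member of $\mathcal{K}$. Algebras have nonempty universes. -}

module Defs where

open import Level using (Level; _⊔_; suc; 0ℓ)
open import Data.Nat using (ℕ)
open import Data.Fin using (Fin)
open import Data.List using (List)
open import Data.List.Membership.Propositional using (_∈_)
open import Data.Product using (Σ; _×_; _,_; proj₁; proj₂; ∃-syntax)
open import Relation.Binary.PropositionalEquality using (_≡_)
open import Relation.Binary.Structures using (IsEquivalence)

record Language : Set₁ where
  field
    Op    : Set
    arity : Op → ℕ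

module _ (L : Language) where
  open Language L

  data Term : Set where
    var : ℕ → Term
    op  : (f : Op) → (Fin (arity f) → Term) → Term

  Equation : Set
  Equation = Term × Term

  -- substitutions = endomorphisms of the term algebra
  -- (determined by their values on the variables)
  subst : (ℕ → Term) → Term → Term
  subst σ (var x)   = σ x
  subst σ (op f ts) = op f (λ i → subst σ (ts i))

  -- L-algebras, as setoids with operations compatible with the
  -- equality; universes are nonempty.

  record Algebra (a ℓ : Level) : Set (suc (a ⊔ ℓ)) where
    field
      Carrier   : Set a
      _≈_       : Carrier → Carrier → Set ℓ
      isEquiv   : IsEquivalence _≈_
      ⟦_⟧       : (f : Op) → (Fin (arity f) → Carrier) → Carrier
      ⟦⟧-cong   : ∀ f (xs ys : Fin (arity f) → Carrier) →
                  (∀ i → xs i ≈ ys i) → ⟦ f ⟧ xs ≈ ⟦ f ⟧ ys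
      inhabitant : Carrier

  open Algebra public

  eval : ∀ {a ℓ} (A : Algebra a ℓ) → (ℕ → Carrier A) → Term → Carrier A
  eval A g (var x)   = g x
  eval A g (op f ts) = ⟦ A ⟧ f (λ i → eval A g (ts i))

  Class : Set₁
  Class = Algebra 0ℓ 0ℓ → Set

  SatisfiableIn : ∀ {a ℓ} → Algebra a ℓ → List Equation → Set (a ⊔ ℓ)
  SatisfiableIn A Σ′ = ∃[ g ] (∀ {e} → e ∈ Σ′ →
                         _≈_ A (eval A g (proj₁ e)) (eval A g (proj₂ e)))

  SatisfiableInClass : Class → List Equation → Set₁
  SatisfiableInClass 𝒦 Σ′ = ∃[ A ] (𝒦 A × SatisfiableIn A Σ′)

  Unifiable : Class → List Equation → Set₁
  Unifiable 𝒦 Σ′ = ∃[ σ ] (∀ {e} → e ∈ Σ′ → ∀ (A : Algebra 0ℓ 0ℓ) → 𝒦 A →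
                     ∀ (g : ℕ → Carrier A) →
                     _≈_ A (eval A g (subst σ (proj₁ e))) (eval A g (subst σ (proj₂ e))))

  record IsCongruence (φ : Term → Term → Set) : Set where
    field
      isEquiv : IsEquivalence φ
      compat  : ∀ f (ss ts : Fin (arity f) → Term) →
                (∀ i → φ (ss i) (ts i)) → φ (op f ss) (op f ts)

  IsHom : ∀ {a ℓ} (A : Algebra a ℓ) → (Term → Carrier A) → Set ℓ
  IsHom A h = ∀ f (ts : Fin (arity f) → Term) →
              _≈_ A (h (op f ts)) (⟦ A ⟧ f (λ i → h (ts i)))

  -- Tm/φ is isomorphic to a subalgebra of A: there is a homomorphism
  -- h : Tm → A whose kernel is exactly φ (its image is the subalgebra)
  QuotientEmbedsInto : (Term → Term → Set) → Algebra 0ℓ 0ℓ → Set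
  QuotientEmbedsInto φ A =
    ∃[ h ] (IsHom A h × (∀ s t → (φ s t → _≈_ A (h s) (h t))
                               × (_≈_ A (h s) (h t) → φ s t)))

  θ : Class → Term → Term → Set₁
  θ 𝒦 s t = ∀ (φ : Term → Term → Set) → IsCongruence φ →
            (∃[ A ] (𝒦 A × QuotientEmbedsInto φ A)) → φ s t

  F : (𝒦 : Class) → Algebra 0ℓ (suc 0ℓ)
  F 𝒦 = record
    { Carrier = Term
    ; _≈_ = θ 𝒦
    ; isEquiv = record
        { refl  = λ φ c _ → IsEquivalence.refl (IsCongruence.isEquiv c)
        ; sym   = λ p φ c e → IsEquivalence.sym (IsCongruence.isEquiv c) (p φ c e)
        ; trans = λ p q φ c e → IsEquivalence.trans (IsCongruence.isEquiv c) (p φ c e) (q φ c e)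
        }
    ; ⟦_⟧ = op
    ; ⟦⟧-cong = λ f xs ys p φ c e → IsCongruence.compat c f xs ys (λ i → p i φ c e)
    ; inhabitant = var 0
    }

  -- Subalgebras (subuniverses of a setoid algebra: nonempty, closed
  -- under the operations and saturated w.r.t. the equality, i.e. a
  -- subset of the quotient)

  record IsSubuniverse {a ℓ} (A : Algebra a ℓ) (P : Carrier A → Set) : Set (a ⊔ ℓ) where
    field
      closed    : ∀ f (xs : Fin (arity f) → Carrier A) → (∀ i → P (xs i)) → P (⟦ A ⟧ f xs)
      saturated : ∀ {x y} → _≈_ A x y → P x → P y
      nonempty  : Σ (Carrier A) P

  Sub : ∀ {a ℓ} (A : Algebra a ℓ) (P : Carrier A → Set) → IsSubuniverse A P → Algebra a ℓ
  Sub A P S = record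
    { Carrier = Σ (Carrier A) P
    ; _≈_ = λ x y → _≈_ A (proj₁ x) (proj₁ y)
    ; isEquiv = record
        { refl  = IsEquivalence.refl (isEquiv A)
        ; sym   = IsEquivalence.sym (isEquiv A)
        ; trans = IsEquivalence.trans (isEquiv A)
        }
    ; ⟦_⟧ = λ f xs → ⟦ A ⟧ f (λ i → proj₁ (xs i)) , IsSubuniverse.closed S f _ (λ i → proj₂ (xs i))
    ; ⟦⟧-cong = λ f xs ys p → ⟦⟧-cong A f _ _ p
    ; inhabitant = IsSubuniverse.nonempty S
    }

  HasSize : ∀ {a ℓ} → Algebra a ℓ → ℕ → Set (a ⊔ ℓ)
  HasSize A n = Σ (Fin n → Carrier A) λ e → ((∀ (i j : Fin n) → _≈_ A (e i) (e j) → i ≡ j)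
                        × (∀ x → ∃[ i ] _≈_ A (e i) x))

  AtLeast : ∀ {a ℓ} → ℕ → Algebra a ℓ → Set (a ⊔ ℓ)
  AtLeast n B = Σ (Fin n → Carrier B) λ e → (∀ (i j : Fin n) → _≈_ B (e i) (e j) → i ≡ j)

-- (a) An assignment g into C satisfies Σ exactly when the substitution proj₁ ∘ g
-- unifies Σ, because θ_𝒦 relates s and t iff s ≈ t is valid in 𝒦. Conversely, a
-- unifier lands in C once a fixed element of C is substituted for every variable.
-- (b) If some B ∈ 𝒦′ had only k < n = |C| elements, every finite part of the
-- diagram of B over them would be 𝒦′-satisfiable, hence 𝒦-unifiable, hence
-- realized in C by (a). There are only n ^ k maps from these k elements into C, so
-- by compactness one of them realizes the whole diagram; its image is then a
-- subalgebra of F_𝒦(ω) with at most k elements, contradicting the minimality of C.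
module Submission where

open import Defs
open import Level using (Level; _⊔_; 0ℓ; Lift; lift; lower) renaming (suc to lsuc)
open import Axiom.ExcludedMiddle using (ExcludedMiddle)
open import Axiom.DoubleNegationElimination using (em⇒dne)
open import Data.Nat using (ℕ; zero; suc; _≤_; _<_; z≤n; s≤s; _^_)
open import Data.Nat.Properties using (≤-refl; ≤-trans; m≤n⇒m≤1+n; m<n⇒m<1+n; <⇒≱)
open import Data.Fin using (Fin; zero; suc; toℕ; finToFun; funToFin)
open import Data.Fin.Properties using (finToFun-funToFin)
open import Data.Vec.Functional using (_∷_)
open import Data.List using (List; map; tabulate)
open import Data.List.Membership.Propositional using (_∈_)
open import Data.List.Membership.Propositional.Properties using (∈-map⁺; ∈-map⁻; ∈-tabulate⁺)
open import Data.Product using (Σ; ∃; _×_; _,_; proj₁; proj₂)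
open import Data.Sum using (_⊎_; inj₁; inj₂)
open import Data.Empty using (⊥-elim)
open import Function using (_∘_; id)
open import Relation.Nullary using (¬_; yes; no; contradiction)
open import Relation.Nullary.Decidable using (True; toWitness; fromWitness; map′)
open import Relation.Binary using (Setoid; Symmetric)
open import Relation.Binary.PropositionalEquality using (_≡_; refl; cong; sym)
open import Relation.Binary.Structures using (IsEquivalence)
import Relation.Binary.Reasoning.Setoid as SetoidReasoning

private variable
  a ℓ : Level

lowerEM : ∀ b → ExcludedMiddle (a ⊔ b) → ExcludedMiddle a
lowerEM b em = map′ lower lift (em {Lift b _})

¬∀⇒∃¬ : ∀ {b} → ExcludedMiddle (a ⊔ b) → {A : Set a} {P : A → Set b} →
        ¬ (∀ x → P x) → ∃ λ x → ¬ P x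
¬∀⇒∃¬ {a} em ¬∀ = em⇒dne em λ ¬∃ → ¬∀ λ x → em⇒dne (lowerEM a em) λ ¬Px → ¬∃ (x , ¬Px)

finite-compactness : ExcludedMiddle (a ⊔ ℓ) → ∀ {N} {D : Set a} (Holds : Fin N → D → Set ℓ) →
                     ((ds : List D) → ∃ λ i → ∀ {d} → d ∈ ds → Holds i d) →
                     ∃ λ i → ∀ d → Holds i d
finite-compactness em Holds finitely = em⇒dne em λ ¬solution →
  let counterexample i = ¬∀⇒∃¬ em (λ holds → ¬solution (i , holds))
      i , holds = finitely (tabulate (proj₁ ∘ counterexample))
  in proj₂ (counterexample i) (holds (∈-tabulate⁺ i))

module _ {X : Set a} (R : X → X → Set ℓ) where

  InjectiveUpTo : ∀ {k} → (Fin k → X) → Set ℓ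
  InjectiveUpTo v = ∀ i j → R (v i) (v j) → i ≡ j

  ∷-injectiveUpTo : Symmetric R → ∀ {k x} {v : Fin k → X} →
                    (∀ i → ¬ R (v i) x) → InjectiveUpTo v → InjectiveUpTo (x ∷ v)
  ∷-injectiveUpTo R-sym new inj zero    zero    _ = refl
  ∷-injectiveUpTo R-sym new inj zero    (suc j) r = contradiction (R-sym r) (new j)
  ∷-injectiveUpTo R-sym new inj (suc i) zero    r = contradiction r (new i)
  ∷-injectiveUpTo R-sym new inj (suc i) (suc j) r = cong suc (inj i j r)

pad : {X : Set a} {k : ℕ} → X → (Fin k → X) → ℕ → X
pad {k = zero}  x₀ v _       = x₀
pad {k = suc k} x₀ v zero    = v zero
pad {k = suc k} x₀ v (suc m) = pad x₀ (v ∘ suc) m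

pad-toℕ : {X : Set a} {k : ℕ} (x₀ : X) (v : Fin k → X) (i : Fin k) → pad x₀ v (toℕ i) ≡ v i
pad-toℕ x₀ v zero    = refl
pad-toℕ x₀ v (suc i) = pad-toℕ x₀ (v ∘ suc) i

module _ {L : Language} where
  open Language L using (Op; arity)

  setoid : Algebra L a ℓ → Setoid a ℓ
  setoid A = record { Carrier = Carrier A ; _≈_ = _≈_ A ; isEquivalence = isEquiv A }

  CoveredBy : Algebra L a ℓ → ℕ → Set (a ⊔ ℓ)
  CoveredBy A k = Σ (Fin k → Carrier A) λ v → ∀ x → ∃ λ i → _≈_ A (v i) x

  module _ (A : Algebra L a ℓ) where
    private module ≈ = IsEquivalence (isEquiv A)

    eval-subst : ∀ g σ t → _≈_ A (eval L A g (subst L σ t)) (eval L A (eval L A g ∘ σ) t)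
    eval-subst g σ (var x)   = ≈.refl
    eval-subst g σ (op f ts) = ⟦⟧-cong A f _ _ (λ i → eval-subst g σ (ts i))

    hom≈eval : ∀ {h} → IsHom L A h → ∀ t → _≈_ A (h t) (eval L A (h ∘ var) t)
    hom≈eval         hom (var x)   = ≈.refl
    hom≈eval {h = h} hom (op f ts) = ≈.trans (hom f ts) (⟦⟧-cong A f _ _ (λ i → hom≈eval {h} hom (ts i)))

    atLeast⊎coveredBy< : ExcludedMiddle (a ⊔ ℓ) → ∀ n → AtLeast L n A ⊎ ∃ λ k → k < n × CoveredBy A k
    atLeast⊎coveredBy< em zero = inj₁ ((λ ()) , λ ())
    atLeast⊎coveredBy< em (suc n) with atLeast⊎coveredBy< em n
    ... | inj₂ (k , k<n , cover) = inj₂ (k , m<n⇒m<1+n k<n , cover)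
    ... | inj₁ (v , inj) with em {∃ λ x → ∀ i → ¬ _≈_ A (v i) x}
    ...   | yes (x , new) = inj₁ (x ∷ v , ∷-injectiveUpTo (_≈_ A) ≈.sym new inj)
    ...   | no ¬new = inj₂ (n , ≤-refl , v , λ x →
                        em⇒dne (lowerEM a em) λ ¬hit → ¬new (x , λ i p → ¬hit (i , p)))

    deduplicate : ExcludedMiddle ℓ → ∀ {k} (v : Fin k → Carrier A) →
                  ∃ λ m → m ≤ k × Σ (Fin m → Carrier A) λ w →
                    InjectiveUpTo (_≈_ A) w × (∀ j → ∃ λ i → _≈_ A (w i) (v j))
    deduplicate em {zero} v = 0 , z≤n , (λ ()) , (λ ()) , λ ()
    deduplicate em {suc k} v with deduplicate em (v ∘ suc)
    ... | m , m≤k , w , inj , hits with em {∃ λ i → _≈_ A (w i) (v zero)}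
    ...   | yes hit = m , m≤n⇒m≤1+n m≤k , w , inj , λ { zero → hit ; (suc j) → hits j }
    ...   | no ¬hit = suc m , s≤s m≤k , v zero ∷ w ,
                      ∷-injectiveUpTo (_≈_ A) ≈.sym (λ i p → ¬hit (i , p)) inj ,
                      λ { zero → zero , ≈.refl ; (suc j) → suc (proj₁ (hits j)) , proj₂ (hits j) }

    coveredBy⇒hasSize≤ : ExcludedMiddle ℓ → ∀ {k} → CoveredBy A k → ∃ λ m → m ≤ k × HasSize L A m
    coveredBy⇒hasSize≤ em (v , onto) with deduplicate em v
    ... | m , m≤k , w , inj , hits = m , m≤k , w , inj , λ x →
          let j , vj≈x = onto x
              i , wi≈vj = hits j
          in i , ≈.trans wi≈vj vj≈x

    IsClosed : ∀ {k} → (Fin k → Carrier A) → Set ℓ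
    IsClosed {k} h = ∀ f (is : Fin (arity f) → Fin k) → ∃ λ j → _≈_ A (⟦ A ⟧ f (h ∘ is)) (h j)

    -- Deciding membership with em turns the image, a predicate valued in the
    -- universe of the carrier equality, into the Set-valued predicate that
    -- IsSubuniverse asks for.
    Image : ExcludedMiddle ℓ → ∀ {k} → (Fin k → Carrier A) → Carrier A → Set
    Image em h x = True (em {∃ λ j → _≈_ A (h j) x})

    image-isSubuniverse : (em : ExcludedMiddle ℓ) → ∀ {k} {h : Fin k → Carrier A} →
                          Fin k → IsClosed h → IsSubuniverse L A (Image em h)
    image-isSubuniverse em {h = h} j₀ h-closed = record
      { closed    = λ f xs xs∈ →
          let js i   = proj₁ (toWitness (xs∈ i))
              j , hj = h-closed f js
          in fromWitness (j , ≈.trans (≈.sym hj) (⟦⟧-cong A f _ _ (λ i → proj₂ (toWitness (xs∈ i)))))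
      ; saturated = λ x≈y x∈ → let j , hj≈x = toWitness x∈ in fromWitness (j , ≈.trans hj≈x x≈y)
      ; nonempty  = h j₀ , fromWitness (j₀ , ≈.refl)
      }

  module _ (A : Algebra L a ℓ) where
    closed⇒smallSubalgebra : ExcludedMiddle ℓ → ∀ {k} {h : Fin k → Carrier A} → Fin k → IsClosed A h →
      Σ (Carrier A → Set) λ Q → Σ (IsSubuniverse L A Q) λ SQ → ∃ λ m → m ≤ k × HasSize L (Sub L A Q SQ) m
    closed⇒smallSubalgebra em {h = h} j₀ h-closed =
      Image A em h , SQ , coveredBy⇒hasSize≤ (Sub L A (Image A em h) SQ) em
        ((λ j → h j , fromWitness (j , IsEquivalence.refl (isEquiv A))) , λ (x , x∈) → toWitness x∈)
      where SQ = image-isSubuniverse A em j₀ h-closed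

  Valid : Class L → Term L → Term L → Set₁
  Valid 𝒦 s t = ∀ (A : Algebra L 0ℓ 0ℓ) → 𝒦 A → ∀ g → _≈_ A (eval L A g s) (eval L A g t)

  valid-subst : ∀ {𝒦} σ s t → Valid 𝒦 s t → Valid 𝒦 (subst L σ s) (subst L σ t)
  valid-subst σ s t s≈t A A∈𝒦 g = begin
      eval L A g (subst L σ s)    ≈⟨ eval-subst A g σ s ⟩
      eval L A (eval L A g ∘ σ) s ≈⟨ s≈t A A∈𝒦 (eval L A g ∘ σ) ⟩
      eval L A (eval L A g ∘ σ) t ≈⟨ eval-subst A g σ t ⟨
      eval L A g (subst L σ t)    ∎
    where open SetoidReasoning (setoid A)

  module _ {𝒦 : Class L} where
    private module θ = IsEquivalence (isEquiv (F L 𝒦))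

    θ⇒valid : ∀ {s t} → θ L 𝒦 s t → Valid 𝒦 s t
    θ⇒valid s~t A A∈𝒦 g = s~t _ kernel (A , A∈𝒦 , eval L A g , (λ f ts → ≈.refl) , λ s t → id , id)
      where
      module ≈ = IsEquivalence (isEquiv A)
      kernel : IsCongruence L (λ s t → _≈_ A (eval L A g s) (eval L A g t))
      kernel = record
        { isEquiv = record { refl = ≈.refl ; sym = ≈.sym ; trans = ≈.trans }
        ; compat  = λ f ss ts → ⟦⟧-cong A f _ _
        }

    valid⇒θ : ∀ {s t} → Valid 𝒦 s t → θ L 𝒦 s t
    valid⇒θ {s} {t} s≈t φ _ (A , A∈𝒦 , h , hom , ker) = proj₂ (ker s t) (begin
        h s                  ≈⟨ hom≈eval A hom s ⟩
        eval L A (h ∘ var) s ≈⟨ s≈t A A∈𝒦 (h ∘ var) ⟩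
        eval L A (h ∘ var) t ≈⟨ hom≈eval A hom t ⟨
        h t                  ∎)
      where open SetoidReasoning (setoid A)

    subst-∘ : ∀ τ σ t → θ L 𝒦 (subst L τ (subst L σ t)) (subst L (subst L τ ∘ σ) t)
    subst-∘ τ σ (var x)   = θ.refl
    subst-∘ τ σ (op f ts) = ⟦⟧-cong (F L 𝒦) f _ _ (λ i → subst-∘ τ σ (ts i))

    module _ {P : Term L → Set} (S : IsSubuniverse L (F L 𝒦) P) where
      private
        C : Algebra L 0ℓ (lsuc 0ℓ)
        C = Sub L (F L 𝒦) P S

      eval-Sub≈subst : ∀ (g : ℕ → Σ (Term L) P) t → θ L 𝒦 (proj₁ (eval L C g t)) (subst L (proj₁ ∘ g) t)
      eval-Sub≈subst g (var x)   = θ.refl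
      eval-Sub≈subst g (op f ts) = ⟦⟧-cong (F L 𝒦) f _ _ (λ i → eval-Sub≈subst g (ts i))

      subst-closed : ∀ {ρ} → (∀ x → P (ρ x)) → ∀ t → P (subst L ρ t)
      subst-closed ρ∈P (var x)   = ρ∈P x
      subst-closed ρ∈P (op f ts) = IsSubuniverse.closed S f _ (λ i → subst-closed ρ∈P (ts i))

      unifiable⇒satisfiableInSub : ∀ {Σ′} → Unifiable L 𝒦 Σ′ → SatisfiableIn L C Σ′
      unifiable⇒satisfiableInSub {Σ′} (σ , unifies) = g , satisfies
        where
        open SetoidReasoning (setoid (F L 𝒦))
        c = IsSubuniverse.nonempty S
        τ : ℕ → Term L
        τ _ = proj₁ c
        g : ℕ → Carrier C
        g x = subst L τ (σ x) , subst-closed (λ _ → proj₂ c) (σ x)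
        satisfies : ∀ {e} → e ∈ Σ′ → _≈_ C (eval L C g (proj₁ e)) (eval L C g (proj₂ e))
        satisfies {l , r} e∈Σ′ = begin
          proj₁ (eval L C g l)      ≈⟨ eval-Sub≈subst g l ⟩
          subst L (subst L τ ∘ σ) l ≈⟨ subst-∘ τ σ l ⟨
          subst L τ (subst L σ l)   ≈⟨ valid⇒θ (valid-subst τ (subst L σ l) (subst L σ r) (unifies e∈Σ′)) ⟩
          subst L τ (subst L σ r)   ≈⟨ subst-∘ τ σ r ⟩
          subst L (subst L τ ∘ σ) r ≈⟨ eval-Sub≈subst g r ⟨
          proj₁ (eval L C g r)      ∎

      satisfiableInSub⇒unifiable : ∀ {Σ′} → SatisfiableIn L C Σ′ → Unifiable L 𝒦 Σ′
      satisfiableInSub⇒unifiable (g , satisfies) = proj₁ ∘ g , λ {e} e∈Σ′ → θ⇒valid (begin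
          subst L (proj₁ ∘ g) (proj₁ e) ≈⟨ eval-Sub≈subst g (proj₁ e) ⟨
          proj₁ (eval L C g (proj₁ e))  ≈⟨ satisfies e∈Σ′ ⟩
          proj₁ (eval L C g (proj₂ e))  ≈⟨ eval-Sub≈subst g (proj₂ e) ⟩
          subst L (proj₁ ∘ g) (proj₂ e) ∎)
        where open SetoidReasoning (setoid (F L 𝒦))

  -- The positive diagram of B over the generators r: every fact f(r i₁, …) ≈ r j
  -- of B, read as the equation f(x_{i₁}, …) ≈ x_j.
  module Diagram (em : ExcludedMiddle (lsuc 0ℓ))
    {𝒦 𝒦′ : Class L} (sat⇒unif : ∀ Σ′ → SatisfiableInClass L 𝒦′ Σ′ → Unifiable L 𝒦 Σ′)
    {P : Term L → Set} (S : IsSubuniverse L (F L 𝒦) P) {n : ℕ} (C-covered : CoveredBy (Sub L (F L 𝒦) P S) n)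
    {B : Algebra L 0ℓ 0ℓ} (B∈𝒦′ : 𝒦′ B) {k : ℕ} (B-covered : CoveredBy B k) where

    private
      module θ = IsEquivalence (isEquiv (F L 𝒦))
      module ≈B = IsEquivalence (isEquiv B)
      C = Sub L (F L 𝒦) P S
      r = proj₁ B-covered

    Fact : Set
    Fact = Σ Op λ f → Σ (Fin (arity f) → Fin k) λ is → Σ (Fin k) λ j → _≈_ B (⟦ B ⟧ f (r ∘ is)) (r j)

    equation : Fact → Equation L
    equation (f , is , j , _) = op f (var ∘ toℕ ∘ is) , var (toℕ j)

    Realizes : (Fin k → Term L) → Fact → Set₁
    Realizes h (f , is , j , _) = θ L 𝒦 (op f (h ∘ is)) (h j)

    realizes-cong : ∀ {h₁ h₂} → (∀ j → θ L 𝒦 (h₁ j) (h₂ j)) → ∀ d → Realizes h₁ d → Realizes h₂ d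
    realizes-cong h₁≈h₂ (f , is , j , _) h₁-realizes =
      θ.trans (θ.sym (⟦⟧-cong (F L 𝒦) f _ _ (h₁≈h₂ ∘ is))) (θ.trans h₁-realizes (h₁≈h₂ j))

    diagram-satisfiableIn-B : ∀ ds → SatisfiableIn L B (map equation ds)
    diagram-satisfiableIn-B ds = pad (inhabitant B) r , holds
      where
      open SetoidReasoning (setoid B)
      holds : ∀ {e} → e ∈ map equation ds →
              _≈_ B (eval L B (pad (inhabitant B) r) (proj₁ e)) (eval L B (pad (inhabitant B) r) (proj₂ e))
      holds e∈ with ∈-map⁻ equation e∈
      ... | (f , is , j , fact) , _ , refl = begin
        ⟦ B ⟧ f (pad (inhabitant B) r ∘ toℕ ∘ is) ≈⟨ ⟦⟧-cong B f _ _ (≈B.reflexive ∘ pad-toℕ _ r ∘ is) ⟩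
        ⟦ B ⟧ f (r ∘ is)                         ≈⟨ fact ⟩
        r j                                      ≡⟨ pad-toℕ _ r j ⟨
        pad (inhabitant B) r (toℕ j)             ∎

    -- Maps from the k generators to the n listed elements of C, encoded as
    -- Fin (n ^ k) so that there are visibly finitely many.
    candidate : Fin (n ^ k) → Fin k → Term L
    candidate i = proj₁ ∘ proj₁ C-covered ∘ finToFun i

    finite-parts-realized : ∀ ds → ∃ λ i → ∀ {d} → d ∈ ds → Realizes (candidate i) d
    finite-parts-realized ds = funToFin position , λ {d} d∈ds →
        realizes-cong g≈candidate d (satisfied⇒realized d (satisfies (∈-map⁺ equation d∈ds)))
      where
      satisfiable : SatisfiableIn L C (map equation ds)
      satisfiable = unifiable⇒satisfiableInSub S (sat⇒unif _ (B , B∈𝒦′ , diagram-satisfiableIn-B ds))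
      g = proj₁ satisfiable
      satisfies = proj₂ satisfiable
      position : Fin k → Fin n
      position j = proj₁ (proj₂ C-covered (g (toℕ j)))
      g≈candidate : ∀ j → θ L 𝒦 (proj₁ (g (toℕ j))) (candidate (funToFin position) j)
      g≈candidate j = θ.trans (θ.sym (proj₂ (proj₂ C-covered (g (toℕ j)))))
                              (θ.reflexive (cong (proj₁ ∘ proj₁ C-covered) (sym (finToFun-funToFin position j))))
      satisfied⇒realized : ∀ d → _≈_ C (eval L C g (proj₁ (equation d))) (eval L C g (proj₂ (equation d))) →
                           Realizes (proj₁ ∘ g ∘ toℕ) d
      satisfied⇒realized (f , is , j , _) = id

    closed-candidate : ∃ λ i → IsClosed (F L 𝒦) (candidate i)
    closed-candidate = i , λ f is →
        let j , rj≈ = proj₂ B-covered (⟦ B ⟧ f (r ∘ is)) in j , realizes (f , is , j , ≈B.sym rj≈)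
      where
      realized = finite-compactness em (Realizes ∘ candidate) finite-parts-realized
      i = proj₁ realized
      realizes = proj₂ realized

  smallestSubalgebra-bound : ExcludedMiddle (lsuc 0ℓ) → {𝒦 𝒦′ : Class L} →
    (∀ Σ′ → SatisfiableInClass L 𝒦′ Σ′ → Unifiable L 𝒦 Σ′) →
    ∀ {P} (S : IsSubuniverse L (F L 𝒦) P) {n} → CoveredBy (Sub L (F L 𝒦) P S) n →
    (∀ Q (SQ : IsSubuniverse L (F L 𝒦) Q) m → HasSize L (Sub L (F L 𝒦) Q SQ) m → n ≤ m) →
    ∀ {B} → 𝒦′ B → AtLeast L n B
  smallestSubalgebra-bound em {𝒦} sat⇒unif S {n} C-covered minimal {B} B∈𝒦′
    with atLeast⊎coveredBy< B (lowerEM (lsuc 0ℓ) em) n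
  ... | inj₁ n≤|B| = n≤|B|
  ... | inj₂ (k , k<n , B-covered) =
    let open Diagram em sat⇒unif S C-covered B∈𝒦′ B-covered using (closed-candidate)
        i , closed = closed-candidate
        j₀ = proj₁ (proj₂ B-covered (inhabitant B))
        Q , SQ , m , m≤k , |Q|≡m = closed⇒smallSubalgebra (F L 𝒦) em j₀ closed
    in ⊥-elim (<⇒≱ k<n (≤-trans (minimal Q SQ m |Q|≡m) m≤k))

proposition4p2 :
    (L : Language) (𝒦 : Class L) (P : Term L → Set) (S : IsSubuniverse L (F L 𝒦) P) →
    ((Σ′ : List (Equation L)) →
        (Unifiable L 𝒦 Σ′ → SatisfiableIn L (Sub L (F L 𝒦) P S) Σ′)
      × (SatisfiableIn L (Sub L (F L 𝒦) P S) Σ′ → Unifiable L 𝒦 Σ′))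
    ×
    (ExcludedMiddle (lsuc 0ℓ) →
      (n : ℕ) → HasSize L (Sub L (F L 𝒦) P S) n →
      ((Q : Term L → Set) (SQ : IsSubuniverse L (F L 𝒦) Q) (m : ℕ) →
        HasSize L (Sub L (F L 𝒦) Q SQ) m → n ≤ m) →
      (𝒦′ : Class L) →
      ((Σ′ : List (Equation L)) →
          (Unifiable L 𝒦 Σ′ → SatisfiableInClass L 𝒦′ Σ′)
        × (SatisfiableInClass L 𝒦′ Σ′ → Unifiable L 𝒦 Σ′)) →
      (B : Algebra L 0ℓ 0ℓ) → 𝒦′ B → AtLeast L n B)
proposition4p2 L 𝒦 P S =
    (λ Σ′ → unifiable⇒satisfiableInSub S , satisfiableInSub⇒unifiable S)
  , λ em n (e , _ , e-onto) minimal 𝒦′ unif⇔sat B B∈𝒦′ →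
      smallestSubalgebra-bound em (λ Σ′ → proj₂ (unif⇔sat Σ′)) S (e , e-onto) minimal B∈𝒦′
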